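{- Let $r\geq 3$ be an integer, let $G$ be a triangle-free $4$-sunspot-free graph, and let $(L_0,\ldots,L_r)$ be an $r$-leveling in $G$ such that $G[L_r]$ is liberal. Let $H$ be a hole of length at least $6$ in $G[L_r]$, and let $x_1\text{ - }h_1\text{ - }h_2\text{ - }x_2\text{ - }x_1$ be an $H$-flap in $G$ (a $4$-hole with edges $x_1h_1,h_1h_2,h_2x_2,x_2x_1$) where $h_1,h_2\in V(H)$ and $x_1,x_2\in L_{r-1}\cup L_r$. Then $x_1,x_2\in L_r\setminus V(H)$.
   Context: Graphs are finite and simple. A $4$-sunspot in $G$ is a $7$-tuple $(x_1,x_2,x_3,x_4;y_1,y_2,y_3)$ of pairwise distinct vertices such that the edges of $G$ among them are exactly $x_1x_2,x_2x_3,x_3x_4,x_4x_1,x_1y_1,x_2y_2,x_3y_3$; $G$ is $4$-sunspot-free if none exists. An $r$-leveling in $G$ is a tuple $(L_0,\ldots,L_r)$ of pairwise disjoint nonempty vertex subsets such that every vertex of $L_i$ ($1\le i\le r$) has a neighbor in $L_{i-1}$, and any edge between $L_i$ and $L_j$ with $i\neq j$ has $|i-j|=1$. A graph is liberal if for all distinct non-adjacent vertices $x,y$, both $N(x)\setminus N(y)$ and $N(y)\setminus N(x)$ are nonempty. A hole is an induced cycle on at least four vertices, its length being its number of edges; a $4$-hole is a hole of length $4$. For a hole $H$, an $H$-flap in $G$ is a $4$-hole in $G$ sharing at least one edge with $H$. -}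

module Defs where

open import Data.Nat using (ℕ; zero; suc; _≤_; _∸_)
open import Data.Fin using (Fin; toℕ; suc; inject₁)
open import Data.Fin.Subset using (Subset; _∈_; _∉_)
open import Data.Product using (Σ; ∃; ∃-syntax; _×_; _,_)
open import Data.Sum using (_⊎_)
open import Data.List using (List; []; _∷_)
import Data.List.Membership.Propositional as LM
open import Relation.Nullary using (¬_; Dec)
open import Relation.Binary.PropositionalEquality using (_≡_; _≢_)
open import Function.Definitions using (Injective)
open import Function.Bundles using (_⇔_)

record Graph : Set₁ where
  field
    n      : ℕ
    _~_    : Fin n → Fin n → Set
    ~-sym  : ∀ {u v} → u ~ v → v ~ u
    ~-irr  : ∀ {u} → ¬ (u ~ u)
    ~-dec  : ∀ u v → Dec (u ~ v)

open Graph public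

V : Graph → Set
V G = Fin (n G)

TriangleFree : Graph → Set
TriangleFree G = ∀ x y z → ¬ ((_~_ G x y) × (_~_ G y z) × (_~_ G x z))

-- Indices 0,1,2,3 stand for x1,x2,x3,x4 and 4,5,6 for y1,y2,y3.
sunspotEdges : List (ℕ × ℕ)
sunspotEdges = (0 , 1) ∷ (1 , 2) ∷ (2 , 3) ∷ (3 , 0) ∷ (0 , 4) ∷ (1 , 5) ∷ (2 , 6) ∷ []

SunspotEdge : Fin 7 → Fin 7 → Set
SunspotEdge i j = LM._∈_ (toℕ i , toℕ j) sunspotEdges ⊎ LM._∈_ (toℕ j , toℕ i) sunspotEdges

FourSunspot : (G : Graph) → (Fin 7 → V G) → Set
FourSunspot G v = Injective _≡_ _≡_ v × (∀ i j → (_~_ G (v i) (v j)) ⇔ SunspotEdge i j)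

FourSunspotFree : Graph → Set
FourSunspotFree G = ∀ v → ¬ FourSunspot G v

record Leveling (G : Graph) (r : ℕ) (L : Fin (suc r) → Subset (n G)) : Set where
  field
    disjoint : ∀ i j → i ≢ j → ∀ v → v ∈ L i → v ∉ L j
    nonempty : ∀ i → ∃[ v ] v ∈ L i
    backNbr  : ∀ (i : Fin r) v → v ∈ L (suc i) → ∃[ u ] (u ∈ L (inject₁ i) × _~_ G u v)
    adjLevels : ∀ i j u v → u ∈ L i → v ∈ L j → _~_ G u v → i ≢ j →
                (toℕ i ≡ suc (toℕ j)) ⊎ (toℕ j ≡ suc (toℕ i))

Liberal : (G : Graph) → Subset (n G) → Set
Liberal G S = ∀ x y → x ∈ S → y ∈ S → x ≢ y → ¬ (_~_ G x y) →
  (∃[ z ] (z ∈ S × _~_ G z x × ¬ (_~_ G z y))) ×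
  (∃[ z ] (z ∈ S × _~_ G z y × ¬ (_~_ G z x)))

CycAdj : (k : ℕ) → Fin k → Fin k → Set
CycAdj k i j = (toℕ j ≡ suc (toℕ i)) ⊎ (toℕ i ≡ suc (toℕ j))
             ⊎ ((toℕ i ≡ k ∸ 1) × (toℕ j ≡ 0)) ⊎ ((toℕ j ≡ k ∸ 1) × (toℕ i ≡ 0))

IsHole : (G : Graph) → Subset (n G) → (k : ℕ) → (Fin k → V G) → Set
IsHole G S k h = (4 ≤ k) × Injective _≡_ _≡_ h × (∀ i → h i ∈ S)
               × (∀ i j → (_~_ G (h i) (h j)) ⇔ CycAdj k i j)

FourHole : (G : Graph) → V G → V G → V G → V G → Set
FourHole G a b c d =
  (a ≢ b) × (a ≢ c) × (a ≢ d) × (b ≢ c) × (b ≢ d) × (c ≢ d) ×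
  _~_ G a b × _~_ G b c × _~_ G c d × _~_ G d a ×
  ¬ (_~_ G a c) × ¬ (_~_ G b d)

module Submission where

-- Each excluded configuration is completed to an induced 4-sunspot. Its vertices are taken on
-- H, which has no chords between vertices 2, 3 or 4 apart (G is triangle-free and |H| ≥ 6),
-- together with a neighbour in L_{r-2} of a vertex of L_{r-1}, which has no neighbours in L_r.
-- In turn: no vertex of L_{r-1} sees two vertices at distance 2 on H; no flap u-hᵢ-hᵢ₊₁-v has
-- u ∈ L_{r-1} (when v ∈ L_r sees hᵢ₋₁, liberality of G[L_r] supplies the missing leaves); and no
-- vertex x ≠ hᵢ of L_{r-1} ∪ L_r sees both hᵢ₋₁ and hᵢ₊₁. If an end of the flap lay on H, the
-- other end would be such a vertex x.

open import Defs
open import Data.Bool using (Bool; true; false) renaming (_≟_ to _≟ᵇ_)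
open import Data.Empty using (⊥; ⊥-elim)
open import Data.Fin using (Fin; toℕ; fromℕ; fromℕ<; inject₁; zero; suc) renaming (_≟_ to _≟ᶠ_)
open import Data.Fin.Properties using (all?; toℕ-injective; toℕ-fromℕ; toℕ-fromℕ<; toℕ-inject₁; toℕ<n)
open import Data.Fin.Subset using (Subset; _∈_)
import Data.List.Membership.DecPropositional as DecMembership
open import Data.Nat using (ℕ; zero; suc; _+_; _*_; _≤_; _<_; z≤n; s≤s; s≤s⁻¹) renaming (_≟_ to _≟ℕ_)
open import Data.Nat.DivMod
  using (_%_; _/_; m%n<n; m≡m%n+[m/n]*n; m%n%n≡m%n; %-distribˡ-+; m<n⇒m%n≡m; [m+n]%n≡m%n; n%n≡0)
open import Data.Nat.Properties
  using (+-comm; +-assoc; +-suc; +-identityʳ; +-cancelʳ-≡; ≤-refl; ≤-trans; ≤-antisym; n≤1+n; m≤m+n;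
         <⇒≢; <⇒≱; m≤n⇒m<n∨m≡n)
open import Data.Product using (_×_; _,_; ∃-syntax)
open import Data.Product.Properties using (≡-dec)
open import Data.Sum using (_⊎_; inj₁; inj₂; swap)
open import Data.Vec using (Vec; tabulate)
open import Data.Vec.Properties using (tabulate-cong) renaming (≡-dec to ≡-decᵛ)
import Function.Endo.Propositional as Endo
open import Function.Bundles using (_⇔_; mk⇔; Equivalence)
open import Relation.Binary.PropositionalEquality
  using (_≡_; _≢_; ≢-sym; refl; sym; trans; cong; subst; module ≡-Reasoning)
open import Relation.Nullary using (¬_; Dec; yes; no)
open import Relation.Nullary.Decidable using (_⊎-dec_; _→-dec_; isYes; toWitness)

module Rotation (k′ : ℕ) where
  open ≡-Reasoning

  private
    K : ℕ
    K = suc k′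

  open Endo (Fin K) using (_^_)

  _⊕_ : ℕ → Fin K → Fin K
  j ⊕ i = fromℕ< (m%n<n (j + toℕ i) K)

  next prev : Fin K → Fin K
  next = 1 ⊕_
  prev = k′ ⊕_

  toℕ-⊕ : ∀ j i → toℕ (j ⊕ i) ≡ (j + toℕ i) % K
  toℕ-⊕ j i = toℕ-fromℕ< _

  toℕ≡⇒≡⊕ : ∀ j i {c} → toℕ c ≡ (j + toℕ i) % K → c ≡ j ⊕ i
  toℕ≡⇒≡⊕ j i e = toℕ-injective (trans e (sym (toℕ-⊕ j i)))

  toℕ%K : ∀ (i : Fin K) → toℕ i % K ≡ toℕ i
  toℕ%K i = m<n⇒m%n≡m (toℕ<n i)

  +-%K : ∀ a t → (a + t % K) % K ≡ (a + t) % K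
  +-%K a t = begin
    (a + t % K) % K         ≡⟨ %-distribˡ-+ a (t % K) K ⟩
    (a % K + t % K % K) % K ≡⟨ cong (λ x → (a % K + x) % K) (m%n%n≡m%n t K) ⟩
    (a % K + t % K) % K     ≡⟨ %-distribˡ-+ a t K ⟨
    (a + t) % K             ∎

  K+-%K : ∀ t → (K + t) % K ≡ t % K
  K+-%K t = trans (cong (_% K) (+-comm K t)) ([m+n]%n≡m%n t K)

  ⊕-⊕ : ∀ a b i → a ⊕ (b ⊕ i) ≡ (a + b) ⊕ i
  ⊕-⊕ a b i = toℕ≡⇒≡⊕ (a + b) i (begin
    toℕ (a ⊕ (b ⊕ i))         ≡⟨ toℕ-⊕ a (b ⊕ i) ⟩
    (a + toℕ (b ⊕ i)) % K     ≡⟨ cong (λ t → (a + t) % K) (toℕ-⊕ b i) ⟩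
    (a + (b + toℕ i) % K) % K ≡⟨ +-%K a (b + toℕ i) ⟩
    (a + (b + toℕ i)) % K     ≡⟨ cong (_% K) (+-assoc a b (toℕ i)) ⟨
    (a + b + toℕ i) % K       ∎)

  0⊕ : ∀ i → 0 ⊕ i ≡ i
  0⊕ i = sym (toℕ≡⇒≡⊕ 0 i (sym (toℕ%K i)))

  K⊕ : ∀ i → K ⊕ i ≡ i
  K⊕ i = toℕ-injective (trans (toℕ-⊕ K i) (trans (K+-%K (toℕ i)) (toℕ%K i)))

  next-prev : ∀ i → next (prev i) ≡ i
  next-prev i = trans (⊕-⊕ 1 k′ i) (K⊕ i)

  prev-next : ∀ i → prev (next i) ≡ i
  prev-next i = trans (⊕-⊕ k′ 1 i) (trans (cong (_⊕ i) (+-comm k′ 1)) (K⊕ i))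

  %K-≢ : ∀ {j} t → 0 < j → j < K → (j + t) % K ≢ t
  %K-≢ {j} t 0<j j<K e = not-multiple ((j + t) / K) (+-cancelʳ-≡ t j _ (begin
    j + t                         ≡⟨ m≡m%n+[m/n]*n (j + t) K ⟩
    (j + t) % K + (j + t) / K * K ≡⟨ cong (_+ (j + t) / K * K) e ⟩
    t + (j + t) / K * K           ≡⟨ +-comm t _ ⟩
    (j + t) / K * K + t           ∎))
    where
    not-multiple : ∀ q → j ≢ q * K
    not-multiple zero    j≡0  = <⇒≢ 0<j (sym j≡0)
    not-multiple (suc q) j≡qK = <⇒≱ j<K (subst (K ≤_) (sym j≡qK) (m≤m+n K (q * K)))

  next^≡⊕ : ∀ j i → (next ^ j) i ≡ j ⊕ i
  next^≡⊕ zero    i = sym (0⊕ i)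
  next^≡⊕ (suc j) i = trans (cong next (next^≡⊕ j i)) (⊕-⊕ 1 j i)

  next^-≢ : ∀ {j} i → 0 < j → j < K → (next ^ j) i ≢ i
  next^-≢ {j} i 0<j j<K e =
    %K-≢ (toℕ i) 0<j j<K (trans (sym (toℕ-⊕ j i)) (cong toℕ (trans (sym (next^≡⊕ j i)) e)))

  CycAdj-next : ∀ i → CycAdj K i (next i)
  CycAdj-next i with m≤n⇒m<n∨m≡n (s≤s⁻¹ (toℕ<n i))
  ... | inj₁ i<k′ = inj₁ (trans (toℕ-⊕ 1 i) (m<n⇒m%n≡m (s≤s i<k′)))
  ... | inj₂ i≡k′ = inj₂ (inj₂ (inj₁ (i≡k′ ,
        trans (toℕ-⊕ 1 i) (trans (cong (λ t → suc t % K) i≡k′) (n%n≡0 K)))))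

  CycAdj⇒next∨prev : ∀ {i j} → CycAdj K i j → j ≡ next i ⊎ j ≡ prev i
  CycAdj⇒next∨prev {i} {j} (inj₁ j≡1+i) =
    inj₁ (toℕ≡⇒≡⊕ 1 i (trans (sym (toℕ%K j)) (cong (_% K) j≡1+i)))
  CycAdj⇒next∨prev {i} {j} (inj₂ (inj₁ i≡1+j)) = inj₂ (toℕ≡⇒≡⊕ k′ i (sym (begin
    (k′ + toℕ i) % K        ≡⟨ cong (λ t → (k′ + t) % K) i≡1+j ⟩
    (k′ + suc (toℕ j)) % K  ≡⟨ cong (_% K) (+-suc k′ (toℕ j)) ⟩
    (K + toℕ j) % K         ≡⟨ K+-%K (toℕ j) ⟩
    toℕ j % K               ≡⟨ toℕ%K j ⟩
    toℕ j                   ∎)))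
  CycAdj⇒next∨prev {i} {j} (inj₂ (inj₂ (inj₁ (i≡k′ , j≡0)))) =
    inj₁ (toℕ≡⇒≡⊕ 1 i (trans j≡0 (sym (trans (cong (λ t → suc t % K) i≡k′) (n%n≡0 K)))))
  CycAdj⇒next∨prev {i} {j} (inj₂ (inj₂ (inj₂ (j≡k′ , i≡0)))) =
    inj₂ (toℕ≡⇒≡⊕ k′ i (trans j≡k′ (sym (begin
      (k′ + toℕ i) % K ≡⟨ cong (λ t → (k′ + t) % K) i≡0 ⟩
      (k′ + 0) % K     ≡⟨ cong (_% K) (+-identityʳ k′) ⟩
      k′ % K           ≡⟨ m<n⇒m%n≡m ≤-refl ⟩
      k′               ∎))))

pattern X₁ = zero
pattern X₂ = suc X₁
pattern X₃ = suc X₂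
pattern X₄ = suc X₃
pattern Y₁ = suc X₄
pattern Y₂ = suc Y₁
pattern Y₃ = suc Y₂

sunspotEdge? : ∀ i j → Dec (SunspotEdge i j)
sunspotEdge? i j = ((toℕ i , toℕ j) ∈? sunspotEdges) ⊎-dec ((toℕ j , toℕ i) ∈? sunspotEdges)
  where open DecMembership (≡-dec _≟ℕ_ _≟ℕ_) using (_∈?_)

sunspotAdjacency : Fin 7 → Fin 7 → Bool
sunspotAdjacency i j = isYes (sunspotEdge? i j)

sunspotRow : Fin 7 → Vec Bool 7
sunspotRow i = tabulate (sunspotAdjacency i)

sunspotRow-injective : ∀ i j → sunspotRow i ≡ sunspotRow j → i ≡ j
sunspotRow-injective = toWitness {a? = all? λ i → all? λ j →
  ≡-decᵛ _≟ᵇ_ (sunspotRow i) (sunspotRow j) →-dec i ≟ᶠ j} _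

module _ (G : Graph) where
  open Graph G using () renaming (_~_ to _∼_; ~-sym to ∼-sym; ~-irr to ∼-irr; ~-dec to ∼-dec)

  ≁-sym : ∀ {x y} → ¬ x ∼ y → ¬ y ∼ x
  ≁-sym x≁y y∼x = x≁y (∼-sym y∼x)

  FourHole-reverse : ∀ {a b c d} → FourHole G a b c d → FourHole G d c b a
  FourHole-reverse (a≢b , a≢c , a≢d , b≢c , b≢d , c≢d , a∼b , b∼c , c∼d , d∼a , a≁c , b≁d) =
    ≢-sym c≢d , ≢-sym b≢d , ≢-sym a≢d , ≢-sym b≢c , ≢-sym a≢c , ≢-sym a≢b ,
    ∼-sym c∼d , ∼-sym b∼c , ∼-sym a∼b , ∼-sym d∼a , ≁-sym b≁d , ≁-sym a≁c

  HasEdge : Bool → V G → V G → Set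
  HasEdge true  x y = x ∼ y
  HasEdge false x y = ¬ x ∼ y

  HasEdge-functional : ∀ b c {x y} → HasEdge b x y → HasEdge c x y → b ≡ c
  HasEdge-functional true  true  _   _   = refl
  HasEdge-functional true  false x∼y x≁y = ⊥-elim (x≁y x∼y)
  HasEdge-functional false true  x≁y x∼y = ⊥-elim (x≁y x∼y)
  HasEdge-functional false false _   _   = refl

  -- Injectivity comes for free: distinct positions of the pattern have distinct rows.
  realisesSunspot : (v : Fin 7 → V G) → (∀ i j → HasEdge (sunspotAdjacency i j) (v i) (v j)) →
                    FourSunspot G v
  realisesSunspot v edges = v-injective , λ i j → adjacency⇔ i j (edges i j)
    where
    v-injective : ∀ {i j} → v i ≡ v j → i ≡ j
    v-injective {i} {j} vi≡vj = sunspotRow-injective i j (tabulate-cong λ w →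
      HasEdge-functional (sunspotAdjacency i w) (sunspotAdjacency j w) (edges i w)
        (subst (λ x → HasEdge (sunspotAdjacency j w) x (v w)) (sym vi≡vj) (edges j w)))

    adjacency⇔ : ∀ i j → HasEdge (sunspotAdjacency i j) (v i) (v j) → (v i ∼ v j) ⇔ SunspotEdge i j
    adjacency⇔ i j vivj with sunspotEdge? i j
    ... | yes ij = mk⇔ (λ _ → ij) (λ _ → vivj)
    ... | no ¬ij = mk⇔ (λ vi∼vj → ⊥-elim (vivj vi∼vj)) (λ ij → ⊥-elim (¬ij ij))

  module NoTriangles (triangleFree : TriangleFree G) where

    noTriangle : ∀ {x y z} → x ∼ y → y ∼ z → ¬ x ∼ z
    noTriangle x∼y y∼z x∼z = triangleFree _ _ _ (x∼y , y∼z , x∼z)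

  module NoSunspots (triangleFree : TriangleFree G) (sunspotFree : FourSunspotFree G) where
    open NoTriangles triangleFree

    -- Only six of the fourteen non-edges are assumed: the other eight would close triangles.
    noSunspot : ∀ x₁ x₂ x₃ x₄ y₁ y₂ y₃ →
      x₁ ∼ x₂ → x₂ ∼ x₃ → x₃ ∼ x₄ → x₄ ∼ x₁ → x₁ ∼ y₁ → x₂ ∼ y₂ → x₃ ∼ y₃ →
      ¬ x₁ ∼ y₃ → ¬ x₃ ∼ y₁ → ¬ x₄ ∼ y₂ → ¬ y₁ ∼ y₂ → ¬ y₁ ∼ y₃ → ¬ y₂ ∼ y₃ → ⊥
    noSunspot x₁ x₂ x₃ x₄ y₁ y₂ y₃ x₁x₂ x₂x₃ x₃x₄ x₄x₁ x₁y₁ x₂y₂ x₃y₃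
              x₁≁y₃ x₃≁y₁ x₄≁y₂ y₁≁y₂ y₁≁y₃ y₂≁y₃ =
      sunspotFree v (realisesSunspot v edges)
      where
      v : Fin 7 → V G
      v X₁ = x₁
      v X₂ = x₂
      v X₃ = x₃
      v X₄ = x₄
      v Y₁ = y₁
      v Y₂ = y₂
      v Y₃ = y₃


      edges : ∀ i j → HasEdge (sunspotAdjacency i j) (v i) (v j)
      edges X₁ X₁ = ∼-irr
      edges X₁ X₂ = x₁x₂
      edges X₁ X₃ = noTriangle x₁x₂ x₂x₃
      edges X₁ X₄ = ∼-sym x₄x₁
      edges X₁ Y₁ = x₁y₁
      edges X₁ Y₂ = noTriangle x₁x₂ x₂y₂
      edges X₁ Y₃ = x₁≁y₃
      edges X₂ X₁ = ∼-sym x₁x₂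
      edges X₂ X₂ = ∼-irr
      edges X₂ X₃ = x₂x₃
      edges X₂ X₄ = noTriangle x₂x₃ x₃x₄
      edges X₂ Y₁ = noTriangle (∼-sym x₁x₂) x₁y₁
      edges X₂ Y₂ = x₂y₂
      edges X₂ Y₃ = noTriangle x₂x₃ x₃y₃
      edges X₃ X₁ = ≁-sym (noTriangle x₁x₂ x₂x₃)
      edges X₃ X₂ = ∼-sym x₂x₃
      edges X₃ X₃ = ∼-irr
      edges X₃ X₄ = x₃x₄
      edges X₃ Y₁ = x₃≁y₁
      edges X₃ Y₂ = noTriangle (∼-sym x₂x₃) x₂y₂
      edges X₃ Y₃ = x₃y₃
      edges X₄ X₁ = x₄x₁
      edges X₄ X₂ = ≁-sym (noTriangle x₂x₃ x₃x₄)
      edges X₄ X₃ = ∼-sym x₃x₄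
      edges X₄ X₄ = ∼-irr
      edges X₄ Y₁ = noTriangle x₄x₁ x₁y₁
      edges X₄ Y₂ = x₄≁y₂
      edges X₄ Y₃ = noTriangle (∼-sym x₃x₄) x₃y₃
      edges Y₁ X₁ = ∼-sym x₁y₁
      edges Y₁ X₂ = ≁-sym (noTriangle (∼-sym x₁x₂) x₁y₁)
      edges Y₁ X₃ = ≁-sym x₃≁y₁
      edges Y₁ X₄ = ≁-sym (noTriangle x₄x₁ x₁y₁)
      edges Y₁ Y₁ = ∼-irr
      edges Y₁ Y₂ = y₁≁y₂
      edges Y₁ Y₃ = y₁≁y₃
      edges Y₂ X₁ = ≁-sym (noTriangle x₁x₂ x₂y₂)
      edges Y₂ X₂ = ∼-sym x₂y₂
      edges Y₂ X₃ = ≁-sym (noTriangle (∼-sym x₂x₃) x₂y₂)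
      edges Y₂ X₄ = ≁-sym x₄≁y₂
      edges Y₂ Y₁ = ≁-sym y₁≁y₂
      edges Y₂ Y₂ = ∼-irr
      edges Y₂ Y₃ = y₂≁y₃
      edges Y₃ X₁ = ≁-sym x₁≁y₃
      edges Y₃ X₂ = ≁-sym (noTriangle x₂x₃ x₃y₃)
      edges Y₃ X₃ = ∼-sym x₃y₃
      edges Y₃ X₄ = ≁-sym (noTriangle (∼-sym x₃x₄) x₃y₃)
      edges Y₃ Y₁ = ≁-sym y₁≁y₃
      edges Y₃ Y₂ = ≁-sym y₂≁y₃
      edges Y₃ Y₃ = ∼-irr

  module Levels {r : ℕ} {L : Fin (suc r) → Subset (n G)} (leveling : Leveling G r L) where
    open Leveling leveling

    InLevel : ℕ → V G → Set
    InLevel ℓ v = ∃[ i ] (v ∈ L i × toℕ i ≡ ℓ)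

    top⇒InLevel : ∀ {v} → v ∈ L (fromℕ r) → InLevel r v
    top⇒InLevel v∈ = fromℕ r , v∈ , toℕ-fromℕ r

    InLevel⇒top : ∀ {v} → InLevel r v → v ∈ L (fromℕ r)
    InLevel⇒top {v} (i , v∈ , i≡r) =
      subst (λ j → v ∈ L j) (toℕ-injective (trans i≡r (sym (toℕ-fromℕ r)))) v∈

    adjacentLevels : ∀ {ℓ ℓ′ u v} → InLevel ℓ u → InLevel ℓ′ v → u ∼ v →
                     ℓ ≡ ℓ′ ⊎ ℓ ≡ suc ℓ′ ⊎ ℓ′ ≡ suc ℓ
    adjacentLevels (i , u∈ , refl) (j , v∈ , refl) u∼v with i ≟ᶠ j
    ... | yes refl = inj₁ refl
    ... | no  i≢j  = inj₂ (adjLevels i j _ _ u∈ v∈ u∼v i≢j)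

    twoApart≁ : ∀ {ℓ u v} → InLevel (2 + ℓ) u → InLevel ℓ v → ¬ u ∼ v
    twoApart≁ u∈ v∈ u∼v with adjacentLevels u∈ v∈ u∼v
    ... | inj₁ ()
    ... | inj₂ (inj₁ ())
    ... | inj₂ (inj₂ ())

    backNeighbour : ∀ {ℓ v} → InLevel (suc ℓ) v → ∃[ u ] (InLevel ℓ u × u ∼ v)
    backNeighbour (suc i , v∈ , refl) with backNbr i _ v∈
    ... | u , u∈ , u∼v = u , (inject₁ i , u∈ , toℕ-inject₁ i) , u∼v

  -- Consecutive positions a ↝ b ↝ c ↝ … along the hole are passed as equations, so that the
  -- lemmas below apply verbatim to the reversed traversal and at positions written with prev.
  record Traversal {k : ℕ} (h : Fin k → V G) : Set where
    field
      next prev   : Fin k → Fin k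
      next-prev   : ∀ i → next (prev i) ≡ i
      prev-next   : ∀ i → prev (next i) ≡ i
      ∼-next      : ∀ i → h i ∼ h (next i)
      ∼⇒next∨prev : ∀ {i j} → h i ∼ h j → j ≡ next i ⊎ j ≡ prev i

    _↝_ : Fin k → Fin k → Set
    i ↝ j = j ≡ next i

    field
      noChord₃ : ∀ {a b c d} → a ↝ b → b ↝ c → c ↝ d → ¬ h a ∼ h d
      noChord₄ : ∀ {a b c d e} → a ↝ b → b ↝ c → c ↝ d → d ↝ e → ¬ h a ∼ h e

  module _ {k : ℕ} {h : Fin k → V G} where

    reverse : Traversal h → Traversal h
    reverse T = record
      { next        = prev
      ; prev        = next
      ; next-prev   = prev-next
      ; prev-next   = next-prev
      ; ∼-next      = λ i → ∼-sym (subst (λ j → h (prev i) ∼ h j) (next-prev i) (∼-next (prev i)))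
      ; ∼⇒next∨prev = λ hi∼hj → swap (∼⇒next∨prev hi∼hj)
      ; noChord₃    = λ ab bc cd → ≁-sym (noChord₃ (back cd) (back bc) (back ab))
      ; noChord₄    = λ ab bc cd de → ≁-sym (noChord₄ (back de) (back cd) (back bc) (back ab))
      }
      where
      open Traversal T
      back : ∀ {a b} → b ≡ prev a → b ↝ a
      back {a} refl = sym (next-prev a)

    reverse-↝ : ∀ (T : Traversal h) {a b} → Traversal._↝_ T a b → Traversal._↝_ (reverse T) b a
    reverse-↝ T {a} refl = sym (Traversal.prev-next T a)

    orientAlong : ∀ {a b} → Traversal h → h a ∼ h b → ∃[ T ] (Traversal._↝_ T a b)
    orientAlong T ha∼hb with Traversal.∼⇒next∨prev T ha∼hb
    ... | inj₁ b≡next = T , b≡next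
    ... | inj₂ b≡prev = reverse T , b≡prev

  holeTraversal : ∀ {S k h} → IsHole G S k h → 6 ≤ k → Traversal h
  holeTraversal {h = h} (_ , _ , _ , ∼⇔CycAdj) 6≤k@(s≤s {n = k′} _) = record
    { next        = next
    ; prev        = prev
    ; next-prev   = next-prev
    ; prev-next   = prev-next
    ; ∼-next      = λ i → Equivalence.from (∼⇔CycAdj i (next i)) (CycAdj-next i)
    ; ∼⇒next∨prev = ∼⇒next∨prev
    ; noChord₃    = λ { refl refl refl → noChord 3 _ (s≤s (s≤s z≤n)) (≤-trans (n≤1+n 5) 6≤k) }
    ; noChord₄    = λ { refl refl refl refl → noChord 4 _ (s≤s (s≤s z≤n)) 6≤k }
    }
    where
    open Rotation k′
    open Endo (Fin (suc k′)) using (_^_)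

    ∼⇒next∨prev : ∀ {i j} → h i ∼ h j → j ≡ next i ⊎ j ≡ prev i
    ∼⇒next∨prev {i} {j} hi∼hj = CycAdj⇒next∨prev (Equivalence.to (∼⇔CycAdj i j) hi∼hj)

    -- A chord from i to nextʲ i would give nextʲ⁻¹ i ≡ i or nextʲ⁺¹ i ≡ i.
    noChord : ∀ j i → 2 ≤ j → suc j < suc k′ → ¬ h i ∼ h ((next ^ j) i)
    noChord (suc j) i (s≤s 1≤j) 2+j<k hi∼hj with ∼⇒next∨prev hi∼hj
    ... | inj₁ e = next^-≢ i 1≤j (≤-trans (n≤1+n _) (≤-trans (n≤1+n _) 2+j<k))
                     (trans (sym (prev-next _)) (trans (cong prev e) (prev-next i)))
    ... | inj₂ e = next^-≢ i (s≤s z≤n) 2+j<k (trans (cong next e) (next-prev i))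

  module Flaps (triangleFree : TriangleFree G) (sunspotFree : FourSunspotFree G)
    {ℓ : ℕ} {L : Fin (3 + ℓ) → Subset (n G)} (leveling : Leveling G (2 + ℓ) L)
    (liberal : Liberal G (L (fromℕ (2 + ℓ))))
    {k : ℕ} {h : Fin k → V G} (h∈top : ∀ i → h i ∈ L (fromℕ (2 + ℓ))) where

    open NoTriangles triangleFree
    open NoSunspots triangleFree sunspotFree
    open Levels leveling

    NearTop : V G → Set
    NearTop v = InLevel (1 + ℓ) v ⊎ InLevel (2 + ℓ) v

    nearTop : ∀ {v} → ∃[ i ] (v ∈ L i × 2 + ℓ ≤ suc (toℕ i)) → NearTop v
    nearTop (i , v∈ , 1+ℓ≤i) with m≤n⇒m<n∨m≡n (s≤s⁻¹ (toℕ<n i))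
    ... | inj₁ i<2+ℓ = inj₁ (i , v∈ , ≤-antisym (s≤s⁻¹ i<2+ℓ) (s≤s⁻¹ 1+ℓ≤i))
    ... | inj₂ i≡2+ℓ = inj₂ (i , v∈ , i≡2+ℓ)

    top≁low : ∀ {x y} → x ∈ L (fromℕ (2 + ℓ)) → InLevel ℓ y → ¬ x ∼ y
    top≁low x∈ = twoApart≁ (top⇒InLevel x∈)

    hole≁low : ∀ {i y} → InLevel ℓ y → ¬ h i ∼ y
    hole≁low = top≁low (h∈top _)

    module BelowTop (T : Traversal h) where
      open Traversal T

      noSpanBelow : ∀ {a b c d e u} → a ↝ b → b ↝ c → c ↝ d → d ↝ e →
                    InLevel (1 + ℓ) u → u ∼ h b → u ∼ h d → ⊥
      noSpanBelow {a} {b} {c} {d} {e} {u} refl refl refl refl u∈ u∼hb u∼hd with backNeighbour u∈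
      ... | y , y∈ , y∼u =
        noSunspot (h b) u (h d) (h c) (h a) y (h e)
          (∼-sym u∼hb) u∼hd (∼-sym (∼-next c)) (∼-sym (∼-next b)) (∼-sym (∼-next a)) (∼-sym y∼u) (∼-next d)
          (noChord₃ refl refl refl) (≁-sym (noChord₃ refl refl refl)) (hole≁low y∈) (hole≁low y∈)
          (noChord₄ refl refl refl refl) (≁-sym (hole≁low y∈))

      noFlapBelow-top : ∀ {a b c d u v} → a ↝ b → b ↝ c → c ↝ d →
                        InLevel (1 + ℓ) u → InLevel (2 + ℓ) v →
                        u ∼ h b → h c ∼ v → v ∼ u → v ≢ h b → v ∼ h a → ⊥
      noFlapBelow-top {a} {b} {c} {d} {u} {v} refl refl refl u∈ v∈ u∼hb hc∼v v∼u v≢hb v∼ha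
        with backNeighbour u∈ | noSpanBelow refl refl refl refl u∈ u∼hb
           | liberal v (h b) (InLevel⇒top v∈) (h∈top b) v≢hb (≁-sym (noTriangle (∼-next b) hc∼v))
      ... | y , y∈ , y∼u | u≁hd | (z , z∈ , z∼v , z≁hb) , (z′ , z′∈ , z′∼hb , z′≁v)
        with ∼-dec z (h d) | ∼-dec z′ (h d)
      ... | no z≁hd | _ =
        noSunspot u v (h c) (h b) y z (h d)
          (∼-sym v∼u) (∼-sym hc∼v) (∼-sym (∼-next b)) (∼-sym u∼hb) (∼-sym y∼u) (∼-sym z∼v) (∼-next c)
          u≁hd (hole≁low y∈) (≁-sym z≁hb) (≁-sym (top≁low z∈ y∈)) (≁-sym (hole≁low y∈)) z≁hd
      ... | yes _ | no z′≁hd =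
        noSunspot (h c) (h b) u v (h d) z′ y
          (∼-sym (∼-next b)) (∼-sym u∼hb) (∼-sym v∼u) (∼-sym hc∼v) (∼-next c) (∼-sym z′∼hb) (∼-sym y∼u)
          (hole≁low y∈) u≁hd (≁-sym z′≁v) (≁-sym z′≁hd) (hole≁low y∈) (top≁low z′∈ y∈)
      ... | yes z∼hd | yes z′∼hd =
        noSunspot (h b) u v (h a) z′ y z
          (∼-sym u∼hb) (∼-sym v∼u) v∼ha (∼-next a) (∼-sym z′∼hb) (∼-sym y∼u) (∼-sym z∼v)
          (≁-sym z≁hb) (≁-sym z′≁v) (hole≁low y∈) (top≁low z′∈ y∈) (noTriangle z′∼hd (∼-sym z∼hd))
          (≁-sym (top≁low z∈ y∈))

      noFlapBelow : ∀ {a b c d u v} → a ↝ b → b ↝ c → c ↝ d →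
                    InLevel (1 + ℓ) u → NearTop v → u ∼ h b → h c ∼ v → v ∼ u → v ≢ h b → ⊥
      noFlapBelow {a} {b} {c} {d} {u} {v} refl refl refl u∈ v∈ u∼hb hc∼v v∼u v≢hb
        with ∼-dec v (h a) | v∈
      ... | yes v∼ha | inj₁ v∈₁ = noSpanBelow (sym (next-prev a)) refl refl refl v∈₁ v∼ha (∼-sym hc∼v)
      ... | yes v∼ha | inj₂ v∈₂ = noFlapBelow-top refl refl refl u∈ v∈₂ u∼hb hc∼v v∼u v≢hb v∼ha
      ... | no v≁ha | _ with backNeighbour u∈
      ...   | y , y∈ , y∼u with ∼-dec v y | v∈
      ...     | yes v∼y | inj₁ _    = noTriangle y∼u (∼-sym v∼u) (∼-sym v∼y)
      ...     | yes v∼y | inj₂ v∈₂  = twoApart≁ v∈₂ y∈ v∼y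
      ...     | no v≁y  | _         =
        noSunspot u (h b) (h c) v y (h a) (h d)
          u∼hb (∼-next b) hc∼v v∼u (∼-sym y∼u) (∼-sym (∼-next a)) (∼-next c)
          (noSpanBelow refl refl refl refl u∈ u∼hb) (hole≁low y∈) v≁ha (≁-sym (hole≁low y∈))
          (≁-sym (hole≁low y∈)) (noChord₃ refl refl refl)

    module _ (T : Traversal h) where
      open Traversal T
      open BelowTop T

      noBypass : ∀ {a b c d e x} → a ↝ b → b ↝ c → c ↝ d → d ↝ e →
                 NearTop x → x ∼ h b → x ∼ h d → x ≢ h c → ⊥
      noBypass refl refl refl refl (inj₁ x∈) x∼hb x∼hd _ = noSpanBelow refl refl refl refl x∈ x∼hb x∼hd
      noBypass {a} {b} {c} {d} {e} {x} refl refl refl refl (inj₂ x∈) x∼hb x∼hd x≢hc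
        with backNeighbour x∈
      ... | w , w∈ , w∼x with ∼-dec w (h c) | ∼-dec w (h a) | ∼-dec w (h e)
      ... | yes w∼hc | _ | _ =
        noFlapBelow refl refl refl w∈ (inj₂ x∈) w∼hc (∼-sym x∼hd) (∼-sym w∼x) x≢hc
      ... | no _ | yes w∼ha | _ =
        noFlapBelow (sym (next-prev a)) refl refl w∈ (inj₂ x∈) w∼ha (∼-sym x∼hb) (∼-sym w∼x)
          (λ x≡ha → noChord₃ refl refl refl (subst (_∼ h d) x≡ha x∼hd))
      ... | no _ | no _ | yes w∼he =
        BelowTop.noFlapBelow (reverse T) (sym (prev-next e)) (sym (prev-next d)) (sym (prev-next c))
          w∈ (inj₂ x∈) w∼he (∼-sym x∼hd) (∼-sym w∼x)
          (λ x≡he → noChord₃ refl refl refl (∼-sym (subst (_∼ h b) x≡he x∼hb)))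
      ... | no w≁hc | no w≁ha | no w≁he =
        noSunspot (h b) x (h d) (h c) (h a) w (h e)
          (∼-sym x∼hb) x∼hd (∼-sym (∼-next c)) (∼-sym (∼-next b)) (∼-sym (∼-next a)) (∼-sym w∼x) (∼-next d)
          (noChord₃ refl refl refl) (≁-sym (noChord₃ refl refl refl)) (≁-sym w≁hc) (≁-sym w≁ha)
          (noChord₄ refl refl refl refl) w≁he

      flapEnd-∉hole : ∀ {b c i x₂} → b ↝ c → FourHole G (h i) (h b) (h c) x₂ → NearTop x₂ → ⊥
      flapEnd-∉hole {b} b↝c (_ , hi≢hc , _ , _ , hb≢x₂ , _ , hi∼hb , _ , hc∼x₂ , x₂∼hi , _) x₂∈
        with ∼⇒next∨prev (∼-sym hi∼hb)
      ... | inj₁ i≡next = hi≢hc (cong h (trans i≡next (sym b↝c)))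
      ... | inj₂ refl   = noBypass (sym (next-prev _)) (sym (next-prev b)) b↝c refl
                            x₂∈ x₂∼hi (∼-sym hc∼x₂) (≢-sym hb≢x₂)

      flapEnd : ∀ {b c x₁ x₂} → b ↝ c → FourHole G x₁ (h b) (h c) x₂ → NearTop x₁ → NearTop x₂ →
                x₁ ∈ L (fromℕ (2 + ℓ)) × (∀ i → x₁ ≢ h i)
      flapEnd {b} b↝c (_ , _ , _ , _ , hb≢x₂ , _ , x₁∼hb , _ , hc∼x₂ , x₂∼x₁ , _) (inj₁ x₁∈) x₂∈ =
        ⊥-elim (noFlapBelow (sym (next-prev b)) b↝c refl x₁∈ x₂∈ x₁∼hb hc∼x₂ x₂∼x₁ (≢-sym hb≢x₂))
      flapEnd {b} {c} {x₁} {x₂} b↝c flap (inj₂ x₁∈) x₂∈ = InLevel⇒top x₁∈ , x₁∉hole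
        where
        x₁∉hole : ∀ i → x₁ ≢ h i
        x₁∉hole i x₁≡hi =
          flapEnd-∉hole b↝c (subst (λ x → FourHole G x (h b) (h c) x₂) x₁≡hi flap) x₂∈

lemma2p6 : (r : ℕ) → 3 ≤ r → (G : Graph) → TriangleFree G → FourSunspotFree G →
           (L : Fin (suc r) → Subset (n G)) → Leveling G r L → Liberal G (L (fromℕ r)) →
           (k : ℕ) → 6 ≤ k → (h : Fin k → V G) → IsHole G (L (fromℕ r)) k h →
           (x₁ x₂ : V G) (a b : Fin k) → FourHole G x₁ (h a) (h b) x₂ →
           (∃[ i ] (x₁ ∈ L i × r ≤ suc (toℕ i))) →
           (∃[ i ] (x₂ ∈ L i × r ≤ suc (toℕ i))) →
           (x₁ ∈ L (fromℕ r) × (∀ c → x₁ ≢ h c)) × (x₂ ∈ L (fromℕ r) × (∀ c → x₂ ≢ h c))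
lemma2p6 _ (s≤s (s≤s _)) G triangleFree sunspotFree L leveling liberal k 6≤k h
         hole@(_ , _ , h∈top , _) x₁ x₂ a b flap@(_ , _ , _ , _ , _ , _ , _ , ha∼hb , _) near₁ near₂
  with orientAlong G (holeTraversal G hole 6≤k) ha∼hb
... | T , a↝b =
  flapEnd T a↝b flap (nearTop near₁) (nearTop near₂) ,
  flapEnd (reverse G T) (reverse-↝ G T a↝b) (FourHole-reverse G flap) (nearTop near₂) (nearTop near₁)
  where open Flaps G triangleFree sunspotFree leveling liberal h∈top
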